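{- Let $G$ and $H$ be connected graphs each with at least $2$ vertices. Then \[\mathrm{sn}(G\square H)\ge\max\bigl(\min(|V(H)|,|V(G)|\lambda(H)),\ \min(|V(G)|,|V(H)|\lambda(G))\bigr).\]
   Context: Graphs are finite, multiple edges allowed, no loops; $\lambda$ is edge-connectivity (edges with multiplicity). $G\square H$ is the Cartesian product (vertex set $V(G)\times V(H)$; $(u_1,v_1),(u_2,v_2)$ joined by $e$ edges iff $u_1=u_2$ and $v_1,v_2$ joined by $e$ edges in $H$, or $v_1=v_2$ and $u_1,u_2$ joined by $e$ edges in $G$). Scramble number $\mathrm{sn}$: a scramble is a finite collection of nonempty vertex sets (eggs) each inducing a connected subgraph; its order is $\min(h,e)$ where $h$ is the minimum size of a vertex set meeting every egg and $e$ is the minimum of $|E(A,A^C)|$ over $A\subseteq V$ containing some egg whose complement contains some egg ($+\infty$ if none); $\mathrm{sn}$ is the maximum order. -}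

module Defs where

open import Data.Nat using (ℕ; _≤_; _+_; _*_)
open import Data.Bool using (Bool; true; false; if_then_else_; _xor_)
open import Data.Fin using (Fin; combine)
open import Data.Fin.Subset using (Subset; _∈_; _∉_; _⊆_; ∁; ∣_∣; Nonempty; ⊤)
open import Data.Vec using (lookup)
open import Data.List using (List; []; _∷_; map; concatMap; allFin)
open import Data.Nat.ListAction using (sum)
open import Data.List.Membership.Propositional using () renaming (_∈_ to _∈ₗ_)
open import Data.Product using (_×_; _,_; ∃; ∃-syntax; proj₁; proj₂)
open import Relation.Binary.PropositionalEquality using (_≡_)
open import Relation.Nullary using (¬_)

-- A finite multigraph: vertex set Fin n, and a list of edges
-- (each list entry is one edge; repeated entries = parallel edges).
record Graph : Set where
  constructor mkGraph
  field
    n     : ℕ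
    edges : List (Fin n × Fin n)
open Graph public

Loopless : Graph → Set
Loopless G = ∀ {u v} → (u , v) ∈ₗ edges G → ¬ (u ≡ v)

-- Walks inside a vertex set S (the subgraph induced by S).
data Reach (G : Graph) (S : Subset (n G)) : Fin (n G) → Fin (n G) → Set where
  here : ∀ {u} → u ∈ S → Reach G S u u
  fwd  : ∀ {u v w} → (u , v) ∈ₗ edges G → u ∈ S → v ∈ S → Reach G S v w → Reach G S u w
  bwd  : ∀ {u v w} → (v , u) ∈ₗ edges G → u ∈ S → v ∈ S → Reach G S v w → Reach G S u w

InducesConnected : (G : Graph) → Subset (n G) → Set
InducesConnected G S = Nonempty S × (∀ u v → u ∈ S → v ∈ S → Reach G S u v)

Connected : Graph → Set
Connected G = InducesConnected G ⊤

-- |E(A, A^C)|, counting parallel edges.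
crosses : ∀ {m} → Subset m → Fin m × Fin m → Bool
crosses A (u , v) = lookup A u xor lookup A v

cutSize : (G : Graph) → Subset (n G) → ℕ
cutSize G A = sum (map (λ e → if crosses A e then 1 else 0) (edges G))

IsEdgeConnectivity : Graph → ℕ → Set
IsEdgeConnectivity G l =
  (∃[ A ] (Nonempty A × Nonempty (∁ A) × cutSize G A ≡ l)) ×
  (∀ A → Nonempty A → Nonempty (∁ A) → l ≤ cutSize G A)

-- Cartesian product; vertex (u , v) is encoded as combine u v.
_□_ : Graph → Graph → Graph
G □ H = mkGraph (n G * n H)
  (concatMap (λ u → map (λ e → combine u (proj₁ e) , combine u (proj₂ e)) (edges H)) (allFin (n G))
   Data.List.++
   concatMap (λ v → map (λ e → combine (proj₁ e) v , combine (proj₂ e) v) (edges G)) (allFin (n H)))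

record Scramble (G : Graph) : Set where
  constructor mkScramble
  field
    eggs      : List (Subset (n G))
    eggsConn  : ∀ {E} → E ∈ₗ eggs → InducesConnected G E
open Scramble public

HittingAtLeast : (G : Graph) → Scramble G → ℕ → Set
HittingAtLeast G S k =
  ∀ (C : Subset (n G)) → (∀ {E} → E ∈ₗ eggs S → ∃[ v ] (v ∈ C × v ∈ E)) → k ≤ ∣ C ∣

-- e(S) ≥ k : every egg-cut has size ≥ k (vacuous if there are no egg-cuts, i.e. e = +∞).
EggCutAtLeast : (G : Graph) → Scramble G → ℕ → Set
EggCutAtLeast G S k =
  ∀ (A : Subset (n G)) →
    (∃[ E ] (E ∈ₗ eggs S × E ⊆ A)) →
    (∃[ E ] (E ∈ₗ eggs S × E ⊆ ∁ A)) →
    k ≤ cutSize G A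

-- ||S|| = min(h, e) ≥ k
OrderAtLeast : (G : Graph) → Scramble G → ℕ → Set
OrderAtLeast G S k = HittingAtLeast G S k × EggCutAtLeast G S k

-- sn(G) ≥ k  ⇔  some scramble has order ≥ k  (sn is the maximum order)
ScrambleNumberAtLeast : Graph → ℕ → Set
ScrambleNumberAtLeast G k = ∃[ S ] OrderAtLeast G S k

{-# OPTIONS --safe #-}
-- The copies {u} × H of H in G □ H are connected and pairwise disjoint, so they form a
-- scramble whose hitting number is |V(G)|.  An egg-cut A separating {u} × H from {w} × H
-- contains (u , v) but not (w , v) for every v, so it restricts to a cut of each copy
-- G × {v} and hence contains at least λ(G) edges of each of these |V(H)| disjoint copies.
-- Symmetrically for the copies G × {v}.
module Submission where

open import Defs
open import Data.Nat using (ℕ; zero; suc; _≤_; _+_; _*_; _⊔_; _⊓_; z≤n; s≤s)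
open import Data.Nat.Properties
  using (module ≤-Reasoning; ≤-trans; m≤m+n; m≤n+m; +-mono-≤; m⊓n≤m; m⊓n≤n; ⊔-sel)
open import Data.Nat.ListAction using (sum)
open import Data.Nat.ListAction.Properties using (sum-++)
open import Data.Bool using (Bool; true; if_then_else_)
open import Data.Bool.Properties using (T-≡)
open import Data.Fin using (Fin; combine; remQuot) renaming (zero to fzero; suc to fsuc)
open import Data.Fin.Properties using (_≟_; suc-injective; 0≢1+n; remQuot-combine; combine-remQuot)
open import Data.Fin.Subset using (Subset; _∈_; _⊆_; ∁; ∣_∣; _-_)
open import Data.Fin.Subset.Properties
  using (∈⊤; x∈p∧x≢y⇒x∈p-y; x∈p⇒∣p-x∣<∣p∣; x∉p⇒x∈∁p; x∈∁p⇒x∉p)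
open import Data.Vec using (lookup; tabulate)
open import Data.Vec.Properties using (lookup∘tabulate; lookup⇒[]=; []=⇒lookup)
open import Data.List using (List; []; _∷_; map; concatMap; allFin; _++_; length)
open import Data.List.Properties using (map-++; length-tabulate)
open import Data.List.Membership.Propositional using (lose) renaming (_∈_ to _∈ₗ_)
open import Data.List.Membership.Propositional.Properties
  using (∈-map⁺; ∈-map⁻; ∈-++⁺ˡ; ∈-++⁺ʳ; ∈-concatMap⁺; ∈-allFin)
open import Data.Product using (_×_; _,_; ∃-syntax; proj₁; proj₂)
import Data.Product as Product
open import Data.Sum using (inj₁; inj₂)
open import Function using (_∘_; id; Injective; Equivalence)
open import Relation.Binary.PropositionalEquality using (_≡_; refl; sym; trans; cong; subst)
open import Relation.Nullary using (does)
open import Relation.Nullary.Decidable using (toWitness; dec-true; isYes≗does)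

∈-tabulate⁺ : ∀ {N} {b : Fin N → Bool} {x} → b x ≡ true → x ∈ tabulate b
∈-tabulate⁺ {b = b} {x} bx = lookup⇒[]= x (tabulate b) (trans (lookup∘tabulate b x) bx)

∈-tabulate⁻ : ∀ {N} {b : Fin N → Bool} {x} → x ∈ tabulate b → b x ≡ true
∈-tabulate⁻ {b = b} {x} x∈ = trans (sym (lookup∘tabulate b x)) ([]=⇒lookup x∈)

fibre : ∀ {N m} → (Fin N → Fin m) → Fin m → Subset N
fibre p i = tabulate (λ x → does (p x ≟ i))

∈-fibre⁺ : ∀ {N m} (p : Fin N → Fin m) {i x} → p x ≡ i → x ∈ fibre p i
∈-fibre⁺ p {i} {x} px≡i = ∈-tabulate⁺ (dec-true (p x ≟ i) px≡i)

∈-fibre⁻ : ∀ {N m} (p : Fin N → Fin m) {i x} → x ∈ fibre p i → p x ≡ i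
∈-fibre⁻ p {i} {x} x∈ =
  toWitness (Equivalence.from T-≡ (trans (isYes≗does (p x ≟ i)) (∈-tabulate⁻ x∈)))

preimage : ∀ {M N} → (Fin M → Fin N) → Subset N → Subset M
preimage f A = tabulate (lookup A ∘ f)

∈-preimage⁺ : ∀ {M N} {f : Fin M → Fin N} {A x} → f x ∈ A → x ∈ preimage f A
∈-preimage⁺ fx∈A = ∈-tabulate⁺ ([]=⇒lookup fx∈A)

∈-preimage⁻ : ∀ {M N} {f : Fin M → Fin N} {A x} → x ∈ preimage f A → f x ∈ A
∈-preimage⁻ {f = f} {A} {x} x∈ = lookup⇒[]= (f x) A (∈-tabulate⁻ x∈)

∈-∁-preimage⁺ : ∀ {M N} {f : Fin M → Fin N} {A x} → f x ∈ ∁ A → x ∈ ∁ (preimage f A)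
∈-∁-preimage⁺ fx∈∁A = x∉p⇒x∈∁p (x∈∁p⇒x∉p fx∈∁A ∘ ∈-preimage⁻)

injective⇒≤∣p∣ : ∀ {m N} {p : Subset N} (f : Fin m → Fin N) →
  Injective _≡_ _≡_ f → (∀ i → f i ∈ p) → m ≤ ∣ p ∣
injective⇒≤∣p∣ {zero} f _ _ = z≤n
injective⇒≤∣p∣ {suc m} {p = p} f f-inj f∈p =
  ≤-trans (s≤s (injective⇒≤∣p∣ (f ∘ fsuc) (suc-injective ∘ f-inj) f∘suc∈p-f₀))
          (x∈p⇒∣p-x∣<∣p∣ (f∈p fzero))
  where
  f∘suc∈p-f₀ : ∀ i → f (fsuc i) ∈ p - f fzero
  f∘suc∈p-f₀ i = x∈p∧x≢y⇒x∈p-y (f∈p (fsuc i)) (0≢1+n ∘ sym ∘ f-inj)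

length-allFin : ∀ k → length (allFin k) ≡ k
length-allFin k = length-tabulate {n = k} id

crossings : ∀ {N} → Subset N → List (Fin N × Fin N) → ℕ
crossings A es = sum (map (λ e → if crosses A e then 1 else 0) es)

crossings-++ : ∀ {N} (A : Subset N) xs ys →
  crossings A (xs ++ ys) ≡ crossings A xs + crossings A ys
crossings-++ A xs ys = trans (cong sum (map-++ count xs ys)) (sum-++ (map count xs) (map count ys))
  where
  count : Fin _ × Fin _ → ℕ
  count e = if crosses A e then 1 else 0

crossings-preimage : ∀ {M N} (f : Fin M → Fin N) (A : Subset N) es →
  crossings A (map (Product.map f f) es) ≡ crossings (preimage f A) es
crossings-preimage f A [] = refl
crossings-preimage f A ((u , v) ∷ es)
  rewrite lookup∘tabulate (lookup A ∘ f) u | lookup∘tabulate (lookup A ∘ f) v =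
  cong (_ +_) (crossings-preimage f A es)

crossings-concatMap : ∀ {B : Set} {N c} (A : Subset N) (g : B → List (Fin N × Fin N)) →
  (∀ z → c ≤ crossings A (g z)) → ∀ zs → length zs * c ≤ crossings A (concatMap g zs)
crossings-concatMap A g bound [] = z≤n
crossings-concatMap A g bound (z ∷ zs) =
  subst (_ ≤_) (sym (crossings-++ A (g z) (concatMap g zs)))
        (+-mono-≤ (bound z) (crossings-concatMap A g bound zs))

EdgePreserving : (K L : Graph) → (Fin (n K) → Fin (n L)) → Set
EdgePreserving K L f = ∀ {u v} → (u , v) ∈ₗ edges K → (f u , f v) ∈ₗ edges L

Reach-map : ∀ {K L f S T a b} → EdgePreserving K L f → (∀ {x} → x ∈ S → f x ∈ T) →
  Reach K S a b → Reach L T (f a) (f b)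
Reach-map hom S⇒T (here a∈S)         = here (S⇒T a∈S)
Reach-map hom S⇒T (fwd e a∈S c∈S r) = fwd (hom e) (S⇒T a∈S) (S⇒T c∈S) (Reach-map hom S⇒T r)
Reach-map hom S⇒T (bwd e a∈S c∈S r) = bwd (hom e) (S⇒T a∈S) (S⇒T c∈S) (Reach-map hom S⇒T r)

image-inducesConnected : ∀ {K L f} {T : Subset (n L)} → EdgePreserving K L f → Connected K →
  (∀ a → f a ∈ T) → (∀ {x} → x ∈ T → ∃[ a ] f a ≡ x) → InducesConnected L T
image-inducesConnected {L = L} {f} {T} hom ((a₀ , _) , reach) f∈T onto =
  (f a₀ , f∈T a₀) , λ x y x∈T y∈T → connect (onto x∈T) (onto y∈T)
  where
  connect : ∀ {x y} → ∃[ a ] f a ≡ x → ∃[ b ] f b ≡ y → Reach L T x y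
  connect (a , refl) (b , refl) = Reach-map hom (λ _ → f∈T _) (reach a b ∈⊤ ∈⊤)

module FibreScramble (K : Graph) {m} (p : Fin (n K) → Fin m)
  (fibre-connected : ∀ i → InducesConnected K (fibre p i)) where

  scramble : Scramble K
  scramble = mkScramble (map (fibre p) (allFin m)) egg-connected
    where
    egg-connected : ∀ {E} → E ∈ₗ map (fibre p) (allFin m) → InducesConnected K E
    egg-connected E∈ with ∈-map⁻ (fibre p) E∈
    ... | i , _ , refl = fibre-connected i

  fibre∈eggs : ∀ i → fibre p i ∈ₗ eggs scramble
  fibre∈eggs i = ∈-map⁺ (fibre p) (∈-allFin i)

  hitting : HittingAtLeast K scramble m
  hitting C meets =
    injective⇒≤∣p∣ pick pick-injective (λ i → proj₁ (proj₂ (meets (fibre∈eggs i))))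
    where
    pick : Fin m → Fin (n K)
    pick i = proj₁ (meets (fibre∈eggs i))
    p∘pick : ∀ i → p (pick i) ≡ i
    p∘pick i = ∈-fibre⁻ p (proj₂ (proj₂ (meets (fibre∈eggs i))))
    pick-injective : Injective _≡_ _≡_ pick
    pick-injective {i} {j} eq = trans (sym (p∘pick i)) (trans (cong p eq) (p∘pick j))

  eggCut : ∀ c → (∀ A i j → fibre p i ⊆ A → fibre p j ⊆ ∁ A → c ≤ cutSize K A) →
    EggCutAtLeast K scramble c
  eggCut c separates A (E , E∈ , E⊆A) (F , F∈ , F⊆∁A)
    with ∈-map⁻ (fibre p) E∈ | ∈-map⁻ (fibre p) F∈
  ... | i , _ , refl | j , _ , refl = separates A i j E⊆A F⊆∁A

  scrambleNumber≥ : ∀ c → (∀ A i j → fibre p i ⊆ A → fibre p j ⊆ ∁ A → c ≤ cutSize K A) →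
    ScrambleNumberAtLeast K (m ⊓ c)
  scrambleNumber≥ c separates =
    scramble ,
    (λ C meets → ≤-trans (m⊓n≤m m c) (hitting C meets)) ,
    (λ A E⊆A F⊆∁A → ≤-trans (m⊓n≤n m c) (eggCut c separates A E⊆A F⊆∁A))

scrambleNumberAtLeast-⊔ : ∀ K {a b} → ScrambleNumberAtLeast K a → ScrambleNumberAtLeast K b →
  ScrambleNumberAtLeast K (a ⊔ b)
scrambleNumberAtLeast-⊔ K {a} {b} sn≥a sn≥b with ⊔-sel a b
... | inj₁ a⊔b≡a = subst (ScrambleNumberAtLeast K) (sym a⊔b≡a) sn≥a
... | inj₂ a⊔b≡b = subst (ScrambleNumberAtLeast K) (sym a⊔b≡b) sn≥b

copies-crossings≥ : ∀ {B : Set} {M l} (K : Graph) → IsEdgeConnectivity K l →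
  (ι : B → Fin (n K) → Fin M) (A : Subset M) {a b : Fin (n K)} →
  (∀ z → ι z a ∈ A) → (∀ z → ι z b ∈ ∁ A) → (zs : List B) →
  length zs * l ≤ crossings A (concatMap (λ z → map (Product.map (ι z) (ι z)) (edges K)) zs)
copies-crossings≥ {l = l} K (_ , minimal) ι A {a} {b} a∈A b∈∁A =
  crossings-concatMap A _ λ z →
    subst (l ≤_) (sym (crossings-preimage (ι z) A (edges K)))
      (minimal (preimage (ι z) A) (a , ∈-preimage⁺ (a∈A z)) (b , ∈-∁-preimage⁺ (b∈∁A z)))

module CartesianProduct (G H : Graph) where

  projG : Fin (n G * n H) → Fin (n G)
  projG = proj₁ ∘ remQuot {n G} (n H)

  projH : Fin (n G * n H) → Fin (n H)
  projH = proj₂ ∘ remQuot {n G} (n H)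

  projG-combine : ∀ u v → projG (combine u v) ≡ u
  projG-combine u v = cong proj₁ (remQuot-combine {n G} u v)

  projH-combine : ∀ u v → projH (combine u v) ≡ v
  projH-combine u v = cong proj₂ (remQuot-combine {n G} u v)

  copyOfH : Fin (n G) → Fin (n H) → Fin (n G * n H)
  copyOfH u v = combine u v

  copyOfG : Fin (n H) → Fin (n G) → Fin (n G * n H)
  copyOfG v u = combine u v

  edgesOfHCopies : List (Fin (n G * n H) × Fin (n G * n H))
  edgesOfHCopies =
    concatMap (λ u → map (Product.map (copyOfH u) (copyOfH u)) (edges H)) (allFin (n G))

  edgesOfGCopies : List (Fin (n G * n H) × Fin (n G * n H))
  edgesOfGCopies =
    concatMap (λ v → map (Product.map (copyOfG v) (copyOfG v)) (edges G)) (allFin (n H))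

  edges-□ : edges (G □ H) ≡ edgesOfHCopies ++ edgesOfGCopies
  edges-□ = refl

  copyOfH-edgePreserving : ∀ u → EdgePreserving H (G □ H) (copyOfH u)
  copyOfH-edgePreserving u e = ∈-++⁺ˡ (∈-concatMap⁺ _ (lose (∈-allFin u) (∈-map⁺ _ e)))

  copyOfG-edgePreserving : ∀ v → EdgePreserving G (G □ H) (copyOfG v)
  copyOfG-edgePreserving v e =
    ∈-++⁺ʳ edgesOfHCopies (∈-concatMap⁺ _ (lose (∈-allFin v) (∈-map⁺ _ e)))

  fibre-projG-connected : Connected H → ∀ u → InducesConnected (G □ H) (fibre projG u)
  fibre-projG-connected connected-H u =
    image-inducesConnected (copyOfH-edgePreserving u) connected-H
      (λ v → ∈-fibre⁺ projG (projG-combine u v))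
      (λ {x} x∈ → projH x , subst (λ z → combine z (projH x) ≡ x) (∈-fibre⁻ projG x∈)
                                   (combine-remQuot {n G} (n H) x))

  fibre-projH-connected : Connected G → ∀ v → InducesConnected (G □ H) (fibre projH v)
  fibre-projH-connected connected-G v =
    image-inducesConnected (copyOfG-edgePreserving v) connected-G
      (λ u → ∈-fibre⁺ projH (projH-combine u v))
      (λ {x} x∈ → projG x , subst (λ z → combine (projG x) z ≡ x) (∈-fibre⁻ projH x∈)
                                   (combine-remQuot {n G} (n H) x))

  fibres-projG-separated : ∀ {l} → IsEdgeConnectivity G l → ∀ A u w →
    fibre projG u ⊆ A → fibre projG w ⊆ ∁ A → n H * l ≤ cutSize (G □ H) A
  fibres-projG-separated {l} λ-G A u w u⊆A w⊆∁A = begin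
    n H * l                                                  ≡⟨ cong (_* l) (length-allFin (n H)) ⟨
    length (allFin (n H)) * l                                ≤⟨ copies-crossings≥ G λ-G copyOfG A
                                                                  (λ v → u⊆A (∈-fibre⁺ projG (projG-combine u v)))
                                                                  (λ v → w⊆∁A (∈-fibre⁺ projG (projG-combine w v)))
                                                                  (allFin (n H)) ⟩
    crossings A edgesOfGCopies                               ≤⟨ m≤n+m _ _ ⟩
    crossings A edgesOfHCopies + crossings A edgesOfGCopies  ≡⟨ crossings-++ A edgesOfHCopies edgesOfGCopies ⟨
    crossings A (edgesOfHCopies ++ edgesOfGCopies)           ≡⟨ cong (crossings A) edges-□ ⟨
    cutSize (G □ H) A                                        ∎
    where open ≤-Reasoning

  fibres-projH-separated : ∀ {l} → IsEdgeConnectivity H l → ∀ A v w →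
    fibre projH v ⊆ A → fibre projH w ⊆ ∁ A → n G * l ≤ cutSize (G □ H) A
  fibres-projH-separated {l} λ-H A v w v⊆A w⊆∁A = begin
    n G * l                                                  ≡⟨ cong (_* l) (length-allFin (n G)) ⟨
    length (allFin (n G)) * l                                ≤⟨ copies-crossings≥ H λ-H copyOfH A
                                                                  (λ u → v⊆A (∈-fibre⁺ projH (projH-combine u v)))
                                                                  (λ u → w⊆∁A (∈-fibre⁺ projH (projH-combine u w)))
                                                                  (allFin (n G)) ⟩
    crossings A edgesOfHCopies                               ≤⟨ m≤m+n _ _ ⟩
    crossings A edgesOfHCopies + crossings A edgesOfGCopies  ≡⟨ crossings-++ A edgesOfHCopies edgesOfGCopies ⟨
    crossings A (edgesOfHCopies ++ edgesOfGCopies)           ≡⟨ cong (crossings A) edges-□ ⟨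
    cutSize (G □ H) A                                        ∎
    where open ≤-Reasoning

corollary4p2 : (G H : Graph) →
    Loopless G → Loopless H →
    Connected G → Connected H →
    2 ≤ n G → 2 ≤ n H →
    (lG lH : ℕ) → IsEdgeConnectivity G lG → IsEdgeConnectivity H lH →
    ScrambleNumberAtLeast (G □ H)
      ((n H ⊓ (n G * lH)) ⊔ (n G ⊓ (n H * lG)))
corollary4p2 G H _ _ connected-G connected-H _ _ lG lH λ-G λ-H =
  scrambleNumberAtLeast-⊔ (G □ H)
    (FibreScramble.scrambleNumber≥ (G □ H) projH (fibre-projH-connected connected-G)
      (n G * lH) (fibres-projH-separated λ-H))
    (FibreScramble.scrambleNumber≥ (G □ H) projG (fibre-projG-connected connected-H)
      (n H * lG) (fibres-projG-separated λ-G))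
  where open CartesianProduct G H
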